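{- (a) $\chi_1([1,1,1])\le P_1(1,1,1;2,2,2)=2$. (b) $\chi_1([2,1,1])\le P_1(2,1,1;6,2,2)=3$. (c) $\chi_1([a,1,1])\le P_1(a,1,1;2a,2,2)=4$ for all integers $a\ge 3$. (d) $\chi_1([2,2,1])\le P_1(2,2,1;10,10,2)=5$. (e) $\chi_1([a,2,1])\le P_1(a,2,1;2a,12,2)\le 6$ for all integers $a\ge 3$. (f) $\chi_1([a,3,1])\le P_1(a,3,1;2a,21,2)\le 7$ for all integers $a\ge 3$. (g) $\chi_1([a,4,1])\le P_1(a,4,1;2a,28,2)\le 7$ for all integers $a\ge 4$. (h) $\chi_1([a,b,c])\le P_1(a,b,c;2a,2b,2c)\le 8$ for all positive integers $a\ge b\ge c$.
   Context: For positive integers $a,b,c$, $\mathcal{CC}_1([a,b,c])=\{[x,x+a]\times[y,y+b]\times[z,z+c]: x,y,z\in\mathbb{Z}\}$; the cuboid $[x,x+a]\times[y,y+b]\times[z,z+c]$ has root $(x,y,z)$. Two cuboids touch if their interiors are disjoint and their intersection is a non-degenerate two-dimensional rectangle. A configuration is a finite subset of $\mathcal{CC}_1([a,b,c])$ with pairwise disjoint interiors, and its contact graph has the cuboids as vertices and edges between touching cuboids; $\chi_1([a,b,c])$ is the maximum chromatic number of such contact graphs. For positive integers $X,Y,Z$, $P_1(a,b,c;X,Y,Z)$ denotes the least $n$ for which there is a coloring $\kappa:\mathbb{Z}^3\to\{1,\dots,n\}$ of roots that is periodic with period $X\times Y\times Z$ (i.e. $\kappa(x+X,y,z)=\kappa(x,y+Y,z)=\kappa(x,y,z+Z)=\kappa(x,y,z)$)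 and such that any two touching cuboids of $\mathcal{CC}_1([a,b,c])$ with disjoint interiors have roots of different colors (so that $\kappa$ properly colors every configuration); $P_1(a,b,c;X,Y,Z)=\infty$ if no such coloring exists. -}

module Defs where

open import Data.Nat using (ℕ; _≤_; _<_)
open import Data.Integer using (ℤ; +_; _+_; _⊔_; _⊓_) renaming (_≤_ to _≤ℤ_; _<_ to _<ℤ_)
open import Data.Fin using (Fin)
open import Data.Product using (_×_; _,_; Σ; ∃)
open import Data.Sum using (_⊎_)
open import Data.List using (List)
open import Data.List.Membership.Propositional using (_∈_)
open import Relation.Binary.PropositionalEquality using (_≡_; _≢_)
open import Relation.Nullary using (¬_)

-- A root (x , y , z) ∈ ℤ³ ; it determines the cuboid
-- [x,x+a] × [y,y+b] × [z,z+c] of CC₁([a,b,c]).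
Root : Set
Root = ℤ × ℤ × ℤ

-- Intersection of the closed intervals [x, x+s] and [x', x'+s] is [lo, hi].
lo : ℤ → ℤ → ℤ
lo x x' = x ⊔ x'

hi : ℕ → ℤ → ℤ → ℤ
hi s x x' = (x + + s) ⊓ (x' + + s)

OpenDisj : ℕ → ℤ → ℤ → Set
OpenDisj s x x' = hi s x x' ≤ℤ lo x x'

Point : ℕ → ℤ → ℤ → Set
Point s x x' = lo x x' ≡ hi s x x'

Segment : ℕ → ℤ → ℤ → Set
Segment s x x' = lo x x' <ℤ hi s x x'

InteriorsDisjoint : ℕ → ℕ → ℕ → Root → Root → Set
InteriorsDisjoint a b c (x , y , z) (x' , y' , z') =
  OpenDisj a x x' ⊎ OpenDisj b y y' ⊎ OpenDisj c z z'

-- The intersection of the two (closed) cuboids is a non-degenerate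
-- two-dimensional rectangle: it is a product of three intervals, exactly one
-- of which is a single point and the other two of positive length.
NondegRectangle : ℕ → ℕ → ℕ → Root → Root → Set
NondegRectangle a b c (x , y , z) (x' , y' , z') =
    (Point a x x' × Segment b y y' × Segment c z z')
  ⊎ (Segment a x x' × Point b y y' × Segment c z z')
  ⊎ (Segment a x x' × Segment b y y' × Point c z z')

Touch : ℕ → ℕ → ℕ → Root → Root → Set
Touch a b c p q = InteriorsDisjoint a b c p q × NondegRectangle a b c p q

IsConfiguration : ℕ → ℕ → ℕ → List Root → Set
IsConfiguration a b c L =
  ∀ {p q} → p ∈ L → q ∈ L → p ≢ q → InteriorsDisjoint a b c p q

ContactColourable : ℕ → ℕ → ℕ → List Root → ℕ → Set
ContactColourable a b c L n =
  Σ (Root → Fin n) λ f →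
    ∀ {p q} → p ∈ L → q ∈ L → Touch a b c p q → f p ≢ f q

Chi≤ : ℕ → ℕ → ℕ → ℕ → Set
Chi≤ a b c n = ∀ (L : List Root) → IsConfiguration a b c L → ContactColourable a b c L n

Periodic : ∀ {n} → ℕ → ℕ → ℕ → (Root → Fin n) → Set
Periodic X Y Z κ =
  ∀ x y z → (κ (x + + X , y , z) ≡ κ (x , y , z))
          × (κ (x , y + + Y , z) ≡ κ (x , y , z))
          × (κ (x , y , z + + Z) ≡ κ (x , y , z))

PeriodicColouring : ℕ → ℕ → ℕ → ℕ → ℕ → ℕ → ℕ → Set
PeriodicColouring a b c X Y Z n =
  Σ (Root → Fin n) λ κ → Periodic X Y Z κ ×
    (∀ p q → Touch a b c p q → κ p ≢ κ q)

P₁≡ : ℕ → ℕ → ℕ → ℕ → ℕ → ℕ → ℕ → Set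
P₁≡ a b c X Y Z n =
  PeriodicColouring a b c X Y Z n × (∀ m → m < n → ¬ PeriodicColouring a b c X Y Z m)

P₁≤ : ℕ → ℕ → ℕ → ℕ → ℕ → ℕ → ℕ → Set
P₁≤ a b c X Y Z n = Σ ℕ λ m → m ≤ n × PeriodicColouring a b c X Y Z m

-- χ₁([a,b,c]) ≤ P₁(a,b,c;X,Y,Z): for every n admitting a periodic colouring
-- (in particular for the least one), χ₁([a,b,c]) ≤ n.
Chi≤P₁ : ℕ → ℕ → ℕ → ℕ → ℕ → ℕ → Set
Chi≤P₁ a b c X Y Z = ∀ n → PeriodicColouring a b c X Y Z n → Chi≤ a b c n

module Submission where

open import Data.Nat as ℕ using (ℕ; zero; suc; _≤_; _<_; _*_; s≤s; z≤n; z<s)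
import Data.Nat.Properties as ℕₚ
open import Data.Integer as ℤ
  using (ℤ; +_; -_; _+_; _-_; _%ℕ_; _/ℕ_)
  renaming (_≤_ to _≤ℤ_; _<_ to _<ℤ_; _*_ to _*ℤ_)
import Data.Integer.Properties as ℤₚ
open import Data.Integer.DivMod using (n%ℕd<d; a≡a%ℕn+[a/ℕn]*n)
open import Data.Integer.Tactic.RingSolver using (solve-∀)
open import Data.Fin as Fin using (Fin; #_; toℕ; fromℕ<; inject≤)
open import Data.Fin.Properties using (toℕ-fromℕ<; fromℕ<-cong; inject≤-injective; any?; all?)
import Data.Fin.Properties as Finₚ
open import Data.Vec using (Vec; []; _∷_; lookup)
open import Data.Vec.Functional as Vector using (head; tail)
open import Data.List using (List; []; _∷_; map; allFin)
open import Data.List.Membership.Propositional using (_∈_)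
open import Data.List.Membership.Propositional.Properties using (∈-map⁺; ∈-allFin)
open import Data.List.Relation.Unary.Any using (here; there)
open import Data.List.Relation.Unary.All as All using (All; []; _∷_)
import Data.List.Relation.Unary.All.Properties as Allₚ
open import Data.Product as Product using (∃; ∃-syntax; _×_; _,_; proj₁; proj₂)
open import Data.Sum using (_⊎_; inj₁; inj₂)
open import Data.Unit using (⊤)
open import Data.Empty using (⊥-elim)
open import Function using (_∘_)
open import Relation.Nullary using (¬_; Dec; yes; no; ¬?)
open import Relation.Nullary.Decidable using (True; toWitness; map′; from-yes; from-no; _×-dec_; _⊎-dec_)
open import Relation.Binary using (tri<; tri≈; tri>)
open import Relation.Binary.PropositionalEquality
open import Defs

-- Each colouring has the product form κ (x , y , z) = T (α x) (β y) (γ z),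
-- where each coordinate map is either the residue modulo the period or, when the side s
-- is arbitrary, the parity of ⌊x / s⌋ (period 2s).  Along the contact direction of two
-- touching cuboids the roots differ by ±s, in the two other directions by less than the
-- side, so the classes of the second root lie in finite lists determined by the classes
-- of the first.  Properness of κ thus becomes a finite condition on the table T, which
-- is decided by evaluation, independently of s.  A few explicit cuboids have a contact graph containing a graph that is
-- not properly colourable with one colour fewer (an edge, a triangle, and graphs on ten
-- and nine vertices); non-colourability is decided by a backtracking search.
-- Finally χ₁ ≤ P₁ because a periodic colouring restricts to every configuration.

-- Contact of two roots, coordinate by coordinate

x≡y+d⇒y≡x-d : ∀ {x y d} → x ≡ y + d → y ≡ x - d
x≡y+d⇒y≡x-d {y = y} {d} refl = sym (y+d-d≡y y d)
  where
  y+d-d≡y : ∀ y d → y + d - d ≡ y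
  y+d-d≡y = solve-∀

offsets : ℕ → List ℤ
offsets zero = []
offsets (suc n) = + n ∷ - + n ∷ offsets n

∈-offsets : ∀ {n s} → n < s → + n ∈ offsets s × - + n ∈ offsets s
∈-offsets {s = suc s} n<1+s with ℕₚ.m≤n⇒m<n∨m≡n (ℕ.s≤s⁻¹ n<1+s)
... | inj₂ refl = here refl , there (here refl)
... | inj₁ n<s = Product.map (there ∘ there) (there ∘ there) (∈-offsets n<s)

module _ {s : ℕ} where

  lo-hi-≤ : ∀ {x x'} → x ≤ℤ x' → lo x x' ≡ x' × hi s x x' ≡ x + + s
  lo-hi-≤ x≤x' = ℤₚ.i≤j⇒i⊔j≡j x≤x' , ℤₚ.i≤j⇒i⊓j≡i (ℤₚ.+-monoˡ-≤ (+ s) x≤x')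

  Point-sym : ∀ {x x'} → Point s x x' → Point s x' x
  Point-sym {x} {x'} = subst₂ _≡_ (ℤₚ.⊔-comm x x') (ℤₚ.⊓-comm (x + + s) (x' + + s))

  Segment-sym : ∀ {x x'} → Segment s x x' → Segment s x' x
  Segment-sym {x} {x'} = subst₂ _<ℤ_ (ℤₚ.⊔-comm x x') (ℤₚ.⊓-comm (x + + s) (x' + + s))

  Point⇒OpenDisj : ∀ {x x'} → Point s x x' → OpenDisj s x x'
  Point⇒OpenDisj p = ℤₚ.≤-reflexive (sym p)

  offset⇒Point : ∀ {x x'} → x' ≡ x + + s → Point s x x'
  offset⇒Point {x} refl with lo-hi-≤ (ℤₚ.i≤i+j x (+ s))
  ... | lo≡x+s , hi≡x+s = trans lo≡x+s (sym hi≡x+s)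

  offset⇒Segment : ∀ {x x' n} → n < s → x' ≡ x + + n → Segment s x x'
  offset⇒Segment {x} {n = n} n<s refl with lo-hi-≤ (ℤₚ.i≤i+j x (+ n))
  ... | lo≡x+n , hi≡x+s = subst₂ _<ℤ_ (sym lo≡x+n) (sym hi≡x+s) (ℤₚ.+-monoʳ-< x (ℤ.+<+ n<s))

  Point-≤⇒offset : ∀ {x x'} → x ≤ℤ x' → Point s x x' → x' ≡ x + + s
  Point-≤⇒offset x≤x' p with lo-hi-≤ x≤x'
  ... | lo≡x' , hi≡x+s = trans (sym lo≡x') (trans p hi≡x+s)

  Segment-≤⇒offset : ∀ {x x'} → x ≤ℤ x' → Segment s x x' → ∃[ n ] n < s × x' ≡ x + + n
  Segment-≤⇒offset {x} {x'} x≤x' p with lo-hi-≤ x≤x'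
  ... | lo≡x' , hi≡x+s = ℤ.∣ x' - x ∣ , ℤₚ.drop‿+<+ (subst (_<ℤ + s) (sym ∣d∣≡d) d<s) , x'≡x+∣d∣
    where
    ∣d∣≡d : + ℤ.∣ x' - x ∣ ≡ x' - x
    ∣d∣≡d = ℤₚ.0≤i⇒+∣i∣≡i (ℤₚ.i≤j⇒0≤j-i x≤x')
    x+s-x≡s : ∀ x s → x + s - x ≡ s
    x+s-x≡s = solve-∀
    x+[x'-x]≡x' : ∀ x x' → x + (x' - x) ≡ x'
    x+[x'-x]≡x' = solve-∀
    d<s : x' - x <ℤ + s
    d<s = subst (x' - x <ℤ_) (x+s-x≡s x (+ s)) (ℤₚ.+-monoˡ-< (- x) (subst₂ _<ℤ_ lo≡x' hi≡x+s p))
    x'≡x+∣d∣ : x' ≡ x + + ℤ.∣ x' - x ∣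
    x'≡x+∣d∣ = trans (sym (x+[x'-x]≡x' x x')) (cong (_+_ x) (sym ∣d∣≡d))

  Point⇒offset : ∀ {x x'} → Point s x x' → x' ≡ x + + s ⊎ x' ≡ x - + s
  Point⇒offset {x} {x'} p with ℤₚ.≤-total x x'
  ... | inj₁ x≤x' = inj₁ (Point-≤⇒offset x≤x' p)
  ... | inj₂ x'≤x = inj₂ (x≡y+d⇒y≡x-d (Point-≤⇒offset x'≤x (Point-sym p)))

  Segment⇒offset : ∀ {x x'} → Segment s x x' → ∃[ d ] d ∈ offsets s × x' ≡ x + d
  Segment⇒offset {x} {x'} p with ℤₚ.≤-total x x'
  ... | inj₁ x≤x' = let n , n<s , x'≡x+n = Segment-≤⇒offset x≤x' p in
    + n , proj₁ (∈-offsets n<s) , x'≡x+n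
  ... | inj₂ x'≤x = let n , n<s , x≡x'+n = Segment-≤⇒offset x'≤x (Segment-sym p) in
    - + n , proj₂ (∈-offsets n<s) , x≡y+d⇒y≡x-d x≡x'+n

Segment-refl : ∀ {s x} → 0 < s → Segment s x x
Segment-refl {x = x} 0<s = offset⇒Segment 0<s (sym (ℤₚ.+-identityʳ x))

touch? : ∀ a b c p q → Dec (Touch a b c p q)
touch? a b c (x , y , z) (x' , y' , z') =
  (openDisj? a x x' ⊎-dec openDisj? b y y' ⊎-dec openDisj? c z z')
  ×-dec (point? a x x' ×-dec segment? b y y' ×-dec segment? c z z'
         ⊎-dec segment? a x x' ×-dec point? b y y' ×-dec segment? c z z'
         ⊎-dec segment? a x x' ×-dec segment? b y y' ×-dec point? c z z')
  where
  openDisj? : ∀ s x x' → Dec (OpenDisj s x x')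
  openDisj? s x x' = hi s x x' ℤₚ.≤? lo x x'
  point? : ∀ s x x' → Dec (Point s x x')
  point? s x x' = lo x x' ℤₚ.≟ hi s x x'
  segment? : ∀ s x x' → Dec (Segment s x x')
  segment? s x x' = lo x x' ℤₚ.<? hi s x x'

-- Residues and blocks

module _ (P : ℕ) .{{_ : ℕ.NonZero P}} where

  below-larger-quotient : ∀ {r r' q q'} → r < P → q <ℤ q' → + r + q *ℤ + P <ℤ + r' + q' *ℤ + P
  below-larger-quotient {r} {r'} {q} {q'} r<P q<q' = begin-strict
    + r + q *ℤ + P       <⟨ ℤₚ.+-monoˡ-< (q *ℤ + P) (ℤ.+<+ r<P) ⟩
    + P + q *ℤ + P       ≡⟨ ℤₚ.suc-* q (+ P) ⟨
    ℤ.suc q *ℤ + P       ≤⟨ ℤₚ.*-monoʳ-≤-nonNeg (+ P) (ℤₚ.i<j⇒suc[i]≤j q<q') ⟩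
    q' *ℤ + P            ≤⟨ ℤₚ.i≤j+i (q' *ℤ + P) (+ r') ⟩
    + r' + q' *ℤ + P     ∎
    where open ℤₚ.≤-Reasoning

  divMod-unique : ∀ {r r' q q'} → r < P → r' < P →
                  + r + q *ℤ + P ≡ + r' + q' *ℤ + P → r ≡ r' × q ≡ q'
  divMod-unique {r} {r'} {q} {q'} r<P r'<P eq with ℤₚ.<-cmp q q'
  ... | tri< q<q' _ _ = ⊥-elim (ℤₚ.<-irrefl eq (below-larger-quotient r<P q<q'))
  ... | tri> _ _ q'<q = ⊥-elim (ℤₚ.<-irrefl (sym eq) (below-larger-quotient r'<P q'<q))
  ... | tri≈ _ refl _ =
    ℤₚ.+-injective (subst₂ _≡_ (r+m-m≡r (+ r) (q *ℤ + P)) (r+m-m≡r (+ r') (q *ℤ + P))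
                               (cong (_- q *ℤ + P) eq))
    , refl
    where
    r+m-m≡r : ∀ r m → r + m - m ≡ r
    r+m-m≡r = solve-∀

  divModℕ-+-multiple : ∀ x k → (x + k *ℤ + P) %ℕ P ≡ x %ℕ P × (x + k *ℤ + P) /ℕ P ≡ x /ℕ P + k
  divModℕ-+-multiple x k = divMod-unique (n%ℕd<d (x + k *ℤ + P) P) (n%ℕd<d x P) (begin
    + ((x + k *ℤ + P) %ℕ P) + (x + k *ℤ + P) /ℕ P *ℤ + P  ≡⟨ a≡a%ℕn+[a/ℕn]*n (x + k *ℤ + P) P ⟨
    x + k *ℤ + P                                        ≡⟨ cong (_+ k *ℤ + P) (a≡a%ℕn+[a/ℕn]*n x P) ⟩
    + (x %ℕ P) + x /ℕ P *ℤ + P + k *ℤ + P               ≡⟨ regroup (+ (x %ℕ P)) (x /ℕ P) k (+ P) ⟩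
    + (x %ℕ P) + (x /ℕ P + k) *ℤ + P                    ∎)
    where
    open ≡-Reasoning
    regroup : ∀ r q k p → r + q *ℤ p + k *ℤ p ≡ r + (q + k) *ℤ p
    regroup = solve-∀

  residue : ℤ → Fin P
  residue x = fromℕ< (n%ℕd<d x P)

  rotate : Fin P → ℤ → Fin P
  rotate i d = residue (+ toℕ i + d)

  residue-+ : ∀ x d → residue (x + d) ≡ rotate (residue x) d
  residue-+ x d = fromℕ<-cong _ _ (begin
    (x + d) %ℕ P                           ≡⟨ cong (λ y → (y + d) %ℕ P) (a≡a%ℕn+[a/ℕn]*n x P) ⟩
    (+ (x %ℕ P) + x /ℕ P *ℤ + P + d) %ℕ P  ≡⟨ cong (_%ℕ P) (swap (+ (x %ℕ P)) (x /ℕ P *ℤ + P) d) ⟩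
    (+ (x %ℕ P) + d + x /ℕ P *ℤ + P) %ℕ P  ≡⟨ proj₁ (divModℕ-+-multiple (+ (x %ℕ P) + d) (x /ℕ P)) ⟩
    (+ (x %ℕ P) + d) %ℕ P                  ≡⟨ cong (λ r → (+ r + d) %ℕ P) (toℕ-fromℕ< (n%ℕd<d x P)) ⟨
    (+ toℕ (residue x) + d) %ℕ P           ∎) _ _
    where
    open ≡-Reasoning
    swap : ∀ r m d → r + m + d ≡ r + d + m
    swap = solve-∀

  residue-periodic : ∀ x → residue (x + + P) ≡ residue x
  residue-periodic x = fromℕ<-cong _ _
    (trans (cong (λ m → (x + m) %ℕ P) (sym (ℤₚ.*-identityˡ (+ P))))
           (proj₁ (divModℕ-+-multiple x (+ 1)))) _ _

module _ (s : ℕ) .{{_ : ℕ.NonZero s}} where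

  block : ℤ → Fin 2
  block x = residue 2 (x /ℕ s)

  block-+-multiple : ∀ x k → block (x + k *ℤ + s) ≡ rotate 2 (block x) k
  block-+-multiple x k =
    trans (cong (residue 2) (proj₂ (divModℕ-+-multiple s x k))) (residue-+ 2 (x /ℕ s) k)

  block-periodic : ∀ x → block (x + + (2 * s)) ≡ block x
  block-periodic x = begin
    block (x + + (2 * s))     ≡⟨ cong (λ m → block (x + m)) (ℤₚ.pos-* 2 s) ⟩
    block (x + + 2 *ℤ + s)    ≡⟨ block-+-multiple x (+ 2) ⟩
    rotate 2 (block x) (+ 2)  ≡⟨ rotate-by-2 (block x) ⟩
    block x                   ∎
    where
    open ≡-Reasoning
    rotate-by-2 : ∀ i → rotate 2 i (+ 2) ≡ i
    rotate-by-2 Fin.zero = refl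
    rotate-by-2 (Fin.suc Fin.zero) = refl

  block-+ : ∀ x → block (x + + s) ≡ rotate 2 (block x) (+ 1)
  block-+ x = trans (cong (λ m → block (x + m)) (sym (ℤₚ.*-identityˡ (+ s)))) (block-+-multiple x (+ 1))

  block-- : ∀ x → block (x - + s) ≡ rotate 2 (block x) (- + 1)
  block-- x = trans (cong (λ m → block (x + m)) (sym (ℤₚ.-1*i≡-i (+ s)))) (block-+-multiple x (- + 1))

-- Periodic colourings from finite tables

record PeriodicAbstraction (s P : ℕ) : Set where
  field
    size : ℕ
    class : ℤ → Fin size
    class-periodic : ∀ x → class (x + + P) ≡ class x
    segmentClasses : Fin size → List (Fin size)
    pointClasses : Fin size → List (Fin size)
    class-segment : ∀ {x x'} → Segment s x x' → class x' ∈ segmentClasses (class x)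
    class-point : ∀ {x x'} → Point s x x' → class x' ∈ pointClasses (class x)

open PeriodicAbstraction

residueAbstraction : ∀ s P .{{_ : ℕ.NonZero P}} → PeriodicAbstraction s P
residueAbstraction s P = record
  { size = P
  ; class = residue P
  ; class-periodic = residue-periodic P
  ; segmentClasses = λ i → map (rotate P i) (offsets s)
  ; pointClasses = λ i → map (rotate P i) (+ s ∷ - + s ∷ [])
  ; class-segment = class-segment′
  ; class-point = class-point′
  }
  where
  class-segment′ : ∀ {x x'} → Segment s x x' →
                   residue P x' ∈ map (rotate P (residue P x)) (offsets s)
  class-segment′ {x} p with Segment⇒offset p
  ... | d , d∈offsets , refl =
    subst (_∈ _) (sym (residue-+ P x d)) (∈-map⁺ (rotate P (residue P x)) d∈offsets)
  class-point′ : ∀ {x x'} → Point s x x' →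
                 residue P x' ∈ map (rotate P (residue P x)) (+ s ∷ - + s ∷ [])
  class-point′ {x} p with Point⇒offset p
  ... | inj₁ refl = here (residue-+ P x (+ s))
  ... | inj₂ refl = there (here (residue-+ P x (- + s)))

blockAbstraction : ∀ s .{{_ : ℕ.NonZero s}} → PeriodicAbstraction s (2 * s)
blockAbstraction s = record
  { size = 2
  ; class = block s
  ; class-periodic = block-periodic s
  ; segmentClasses = λ _ → allFin 2
  ; pointClasses = λ i → rotate 2 i (+ 1) ∷ rotate 2 i (- + 1) ∷ []
  ; class-segment = λ _ → ∈-allFin _
  ; class-point = class-point′
  }
  where
  class-point′ : ∀ {x x'} → Point s x x' →
                 block s x' ∈ rotate 2 (block s x) (+ 1) ∷ rotate 2 (block s x) (- + 1) ∷ []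
  class-point′ {x} p with Point⇒offset p
  ... | inj₁ refl = here (block-+ s x)
  ... | inj₂ refl = there (here (block-- s x))

module _ {a b c X Y Z n : ℕ}
         (A : PeriodicAbstraction a X) (B : PeriodicAbstraction b Y) (C : PeriodicAbstraction c Z)
         (table : Fin (size A) → Fin (size B) → Fin (size C) → Fin n) where

  Separates : (Fin (size A) → List (Fin (size A))) → (Fin (size B) → List (Fin (size B))) →
              (Fin (size C) → List (Fin (size C))) → Set
  Separates nA nB nC = ∀ i j k →
    All (λ i' → All (λ j' → All (λ k' → table i j k ≢ table i' j' k') (nC k)) (nB j)) (nA i)

  separates? : ∀ nA nB nC → Dec (Separates nA nB nC)
  separates? nA nB nC = all? λ i → all? λ j → all? λ k →
    All.all? (λ i' → All.all? (λ j' → All.all? (λ k' →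
      ¬? (table i j k Finₚ.≟ table i' j' k')) (nC k)) (nB j)) (nA i)

  ProperTable : Set
  ProperTable = Separates (pointClasses A) (segmentClasses B) (segmentClasses C)
              × Separates (segmentClasses A) (pointClasses B) (segmentClasses C)
              × Separates (segmentClasses A) (segmentClasses B) (pointClasses C)

  properTable? : Dec ProperTable
  properTable? = separates? _ _ _ ×-dec separates? _ _ _ ×-dec separates? _ _ _

  -- As in Data.Fin.#_, the check is an implicit argument that evaluation discharges.
  tableColouring : {proper : True properTable?} → PeriodicColouring a b c X Y Z n
  tableColouring {proper} = κ , periodic , proper′ (toWitness proper)
    where
    κ : Root → Fin n
    κ (x , y , z) = table (class A x) (class B y) (class C z)
    periodic : Periodic X Y Z κ
    periodic x y z = cong (λ i → table i (class B y) (class C z)) (class-periodic A x)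
                   , cong (λ j → table (class A x) j (class C z)) (class-periodic B y)
                   , cong (λ k → table (class A x) (class B y) k) (class-periodic C z)
    separated : ∀ {nA nB nC i j k i' j' k'} → Separates nA nB nC →
                i' ∈ nA i → j' ∈ nB j → k' ∈ nC k → table i j k ≢ table i' j' k'
    separated sep i'∈ j'∈ k'∈ = All.lookup (All.lookup (All.lookup (sep _ _ _) i'∈) j'∈) k'∈
    proper′ : ProperTable → ∀ p q → Touch a b c p q → κ p ≢ κ q
    proper′ (sepX , _ , _) _ _ (_ , inj₁ (px , sy , sz)) =
      separated sepX (class-point A px) (class-segment B sy) (class-segment C sz)
    proper′ (_ , sepY , _) _ _ (_ , inj₂ (inj₁ (sx , py , sz))) =
      separated sepY (class-segment A sx) (class-point B py) (class-segment C sz)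
    proper′ (_ , _ , sepZ) _ _ (_ , inj₂ (inj₂ (sx , sy , pz))) =
      separated sepZ (class-segment A sx) (class-segment B sy) (class-point C pz)

lookup³ : ∀ {A : Set} {l m n} → Vec (Vec (Vec A l) m) n → Fin n → Fin m → Fin l → A
lookup³ t i j k = lookup (lookup (lookup t i) j) k

parity : PeriodicAbstraction 1 2
parity = residueAbstraction 1 2

colouring[1,1,1] : PeriodicColouring 1 1 1 2 2 2 2
colouring[1,1,1] = tableColouring parity parity parity (lookup³ table)
  where
  table : Vec (Vec (Vec (Fin 2) 2) 2) 2
  table =
    ((# 0 ∷ # 1 ∷ []) ∷ (# 1 ∷ # 0 ∷ []) ∷ []) ∷
    ((# 1 ∷ # 0 ∷ []) ∷ (# 0 ∷ # 1 ∷ []) ∷ []) ∷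
    []

colouring[2,1,1] : PeriodicColouring 2 1 1 6 2 2 3
colouring[2,1,1] = tableColouring (residueAbstraction 2 6) parity parity (lookup³ table)
  where
  table : Vec (Vec (Vec (Fin 3) 2) 2) 6
  table =
    ((# 0 ∷ # 1 ∷ []) ∷ (# 1 ∷ # 0 ∷ []) ∷ []) ∷
    ((# 0 ∷ # 2 ∷ []) ∷ (# 2 ∷ # 0 ∷ []) ∷ []) ∷
    ((# 1 ∷ # 2 ∷ []) ∷ (# 2 ∷ # 1 ∷ []) ∷ []) ∷
    ((# 1 ∷ # 0 ∷ []) ∷ (# 0 ∷ # 1 ∷ []) ∷ []) ∷
    ((# 2 ∷ # 0 ∷ []) ∷ (# 0 ∷ # 2 ∷ []) ∷ []) ∷
    ((# 2 ∷ # 1 ∷ []) ∷ (# 1 ∷ # 2 ∷ []) ∷ []) ∷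
    []

colouring[a,1,1] : ∀ a .{{_ : ℕ.NonZero a}} → PeriodicColouring a 1 1 (2 * a) 2 2 4
colouring[a,1,1] a = tableColouring (blockAbstraction a) parity parity (lookup³ table)
  where
  table : Vec (Vec (Vec (Fin 4) 2) 2) 2
  table =
    ((# 0 ∷ # 1 ∷ []) ∷ (# 1 ∷ # 0 ∷ []) ∷ []) ∷
    ((# 2 ∷ # 3 ∷ []) ∷ (# 3 ∷ # 2 ∷ []) ∷ []) ∷
    []

colouring[2,2,1] : PeriodicColouring 2 2 1 10 10 2 5
colouring[2,2,1] =
  tableColouring (residueAbstraction 2 10) (residueAbstraction 2 10) parity (lookup³ table)
  where
  table : Vec (Vec (Vec (Fin 5) 2) 10) 10
  table =
    ((# 0 ∷ # 1 ∷ []) ∷ (# 0 ∷ # 2 ∷ []) ∷ (# 1 ∷ # 2 ∷ []) ∷ (# 1 ∷ # 3 ∷ []) ∷ (# 2 ∷ # 3 ∷ []) ∷ (# 2 ∷ # 4 ∷ []) ∷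
     (# 3 ∷ # 4 ∷ []) ∷ (# 3 ∷ # 0 ∷ []) ∷ (# 4 ∷ # 0 ∷ []) ∷ (# 4 ∷ # 1 ∷ []) ∷ []) ∷
    ((# 3 ∷ # 1 ∷ []) ∷ (# 3 ∷ # 2 ∷ []) ∷ (# 4 ∷ # 2 ∷ []) ∷ (# 4 ∷ # 3 ∷ []) ∷ (# 0 ∷ # 3 ∷ []) ∷ (# 0 ∷ # 4 ∷ []) ∷
     (# 1 ∷ # 4 ∷ []) ∷ (# 1 ∷ # 0 ∷ []) ∷ (# 2 ∷ # 0 ∷ []) ∷ (# 2 ∷ # 1 ∷ []) ∷ []) ∷
    ((# 3 ∷ # 4 ∷ []) ∷ (# 3 ∷ # 0 ∷ []) ∷ (# 4 ∷ # 0 ∷ []) ∷ (# 4 ∷ # 1 ∷ []) ∷ (# 0 ∷ # 1 ∷ []) ∷ (# 0 ∷ # 2 ∷ []) ∷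
     (# 1 ∷ # 2 ∷ []) ∷ (# 1 ∷ # 3 ∷ []) ∷ (# 2 ∷ # 3 ∷ []) ∷ (# 2 ∷ # 4 ∷ []) ∷ []) ∷
    ((# 1 ∷ # 4 ∷ []) ∷ (# 1 ∷ # 0 ∷ []) ∷ (# 2 ∷ # 0 ∷ []) ∷ (# 2 ∷ # 1 ∷ []) ∷ (# 3 ∷ # 1 ∷ []) ∷ (# 3 ∷ # 2 ∷ []) ∷
     (# 4 ∷ # 2 ∷ []) ∷ (# 4 ∷ # 3 ∷ []) ∷ (# 0 ∷ # 3 ∷ []) ∷ (# 0 ∷ # 4 ∷ []) ∷ []) ∷
    ((# 1 ∷ # 2 ∷ []) ∷ (# 1 ∷ # 3 ∷ []) ∷ (# 2 ∷ # 3 ∷ []) ∷ (# 2 ∷ # 4 ∷ []) ∷ (# 3 ∷ # 4 ∷ []) ∷ (# 3 ∷ # 0 ∷ []) ∷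
     (# 4 ∷ # 0 ∷ []) ∷ (# 4 ∷ # 1 ∷ []) ∷ (# 0 ∷ # 1 ∷ []) ∷ (# 0 ∷ # 2 ∷ []) ∷ []) ∷
    ((# 4 ∷ # 2 ∷ []) ∷ (# 4 ∷ # 3 ∷ []) ∷ (# 0 ∷ # 3 ∷ []) ∷ (# 0 ∷ # 4 ∷ []) ∷ (# 1 ∷ # 4 ∷ []) ∷ (# 1 ∷ # 0 ∷ []) ∷
     (# 2 ∷ # 0 ∷ []) ∷ (# 2 ∷ # 1 ∷ []) ∷ (# 3 ∷ # 1 ∷ []) ∷ (# 3 ∷ # 2 ∷ []) ∷ []) ∷
    ((# 4 ∷ # 0 ∷ []) ∷ (# 4 ∷ # 1 ∷ []) ∷ (# 0 ∷ # 1 ∷ []) ∷ (# 0 ∷ # 2 ∷ []) ∷ (# 1 ∷ # 2 ∷ []) ∷ (# 1 ∷ # 3 ∷ []) ∷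
     (# 2 ∷ # 3 ∷ []) ∷ (# 2 ∷ # 4 ∷ []) ∷ (# 3 ∷ # 4 ∷ []) ∷ (# 3 ∷ # 0 ∷ []) ∷ []) ∷
    ((# 2 ∷ # 0 ∷ []) ∷ (# 2 ∷ # 1 ∷ []) ∷ (# 3 ∷ # 1 ∷ []) ∷ (# 3 ∷ # 2 ∷ []) ∷ (# 4 ∷ # 2 ∷ []) ∷ (# 4 ∷ # 3 ∷ []) ∷
     (# 0 ∷ # 3 ∷ []) ∷ (# 0 ∷ # 4 ∷ []) ∷ (# 1 ∷ # 4 ∷ []) ∷ (# 1 ∷ # 0 ∷ []) ∷ []) ∷
    ((# 2 ∷ # 3 ∷ []) ∷ (# 2 ∷ # 4 ∷ []) ∷ (# 3 ∷ # 4 ∷ []) ∷ (# 3 ∷ # 0 ∷ []) ∷ (# 4 ∷ # 0 ∷ []) ∷ (# 4 ∷ # 1 ∷ []) ∷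
     (# 0 ∷ # 1 ∷ []) ∷ (# 0 ∷ # 2 ∷ []) ∷ (# 1 ∷ # 2 ∷ []) ∷ (# 1 ∷ # 3 ∷ []) ∷ []) ∷
    ((# 0 ∷ # 3 ∷ []) ∷ (# 0 ∷ # 4 ∷ []) ∷ (# 1 ∷ # 4 ∷ []) ∷ (# 1 ∷ # 0 ∷ []) ∷ (# 2 ∷ # 0 ∷ []) ∷ (# 2 ∷ # 1 ∷ []) ∷
     (# 3 ∷ # 1 ∷ []) ∷ (# 3 ∷ # 2 ∷ []) ∷ (# 4 ∷ # 2 ∷ []) ∷ (# 4 ∷ # 3 ∷ []) ∷ []) ∷
    []

colouring[a,2,1] : ∀ a .{{_ : ℕ.NonZero a}} → PeriodicColouring a 2 1 (2 * a) 12 2 6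
colouring[a,2,1] a = tableColouring (blockAbstraction a) (residueAbstraction 2 12) parity (lookup³ table)
  where
  table : Vec (Vec (Vec (Fin 6) 2) 12) 2
  table =
    ((# 0 ∷ # 1 ∷ []) ∷ (# 0 ∷ # 4 ∷ []) ∷ (# 1 ∷ # 4 ∷ []) ∷ (# 1 ∷ # 0 ∷ []) ∷ (# 4 ∷ # 0 ∷ []) ∷ (# 4 ∷ # 1 ∷ []) ∷
     (# 0 ∷ # 1 ∷ []) ∷ (# 0 ∷ # 4 ∷ []) ∷ (# 1 ∷ # 4 ∷ []) ∷ (# 1 ∷ # 0 ∷ []) ∷ (# 4 ∷ # 0 ∷ []) ∷ (# 4 ∷ # 1 ∷ []) ∷ []) ∷
    ((# 2 ∷ # 3 ∷ []) ∷ (# 2 ∷ # 5 ∷ []) ∷ (# 3 ∷ # 5 ∷ []) ∷ (# 3 ∷ # 2 ∷ []) ∷ (# 5 ∷ # 2 ∷ []) ∷ (# 5 ∷ # 3 ∷ []) ∷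
     (# 2 ∷ # 3 ∷ []) ∷ (# 2 ∷ # 5 ∷ []) ∷ (# 3 ∷ # 5 ∷ []) ∷ (# 3 ∷ # 2 ∷ []) ∷ (# 5 ∷ # 2 ∷ []) ∷ (# 5 ∷ # 3 ∷ []) ∷ []) ∷
    []

colouring[a,3,1] : ∀ a .{{_ : ℕ.NonZero a}} → PeriodicColouring a 3 1 (2 * a) 21 2 7
colouring[a,3,1] a = tableColouring (blockAbstraction a) (residueAbstraction 3 21) parity (lookup³ table)
  where
  table : Vec (Vec (Vec (Fin 7) 2) 21) 2
  table =
    ((# 0 ∷ # 1 ∷ []) ∷ (# 0 ∷ # 4 ∷ []) ∷ (# 5 ∷ # 4 ∷ []) ∷ (# 5 ∷ # 4 ∷ []) ∷ (# 5 ∷ # 0 ∷ []) ∷ (# 3 ∷ # 0 ∷ []) ∷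
     (# 3 ∷ # 0 ∷ []) ∷ (# 3 ∷ # 5 ∷ []) ∷ (# 6 ∷ # 5 ∷ []) ∷ (# 6 ∷ # 5 ∷ []) ∷ (# 6 ∷ # 3 ∷ []) ∷ (# 2 ∷ # 3 ∷ []) ∷
     (# 2 ∷ # 3 ∷ []) ∷ (# 2 ∷ # 6 ∷ []) ∷ (# 1 ∷ # 6 ∷ []) ∷ (# 1 ∷ # 6 ∷ []) ∷ (# 1 ∷ # 2 ∷ []) ∷ (# 4 ∷ # 2 ∷ []) ∷
     (# 4 ∷ # 2 ∷ []) ∷ (# 4 ∷ # 1 ∷ []) ∷ (# 0 ∷ # 1 ∷ []) ∷ []) ∷
    ((# 2 ∷ # 3 ∷ []) ∷ (# 2 ∷ # 3 ∷ []) ∷ (# 2 ∷ # 3 ∷ []) ∷ (# 1 ∷ # 6 ∷ []) ∷ (# 1 ∷ # 6 ∷ []) ∷ (# 1 ∷ # 6 ∷ []) ∷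
     (# 4 ∷ # 2 ∷ []) ∷ (# 4 ∷ # 2 ∷ []) ∷ (# 4 ∷ # 2 ∷ []) ∷ (# 0 ∷ # 1 ∷ []) ∷ (# 0 ∷ # 1 ∷ []) ∷ (# 0 ∷ # 1 ∷ []) ∷
     (# 5 ∷ # 4 ∷ []) ∷ (# 5 ∷ # 4 ∷ []) ∷ (# 5 ∷ # 4 ∷ []) ∷ (# 3 ∷ # 0 ∷ []) ∷ (# 3 ∷ # 0 ∷ []) ∷ (# 3 ∷ # 0 ∷ []) ∷
     (# 6 ∷ # 5 ∷ []) ∷ (# 6 ∷ # 5 ∷ []) ∷ (# 6 ∷ # 5 ∷ []) ∷ []) ∷
    []

colouring[a,4,1] : ∀ a .{{_ : ℕ.NonZero a}} → PeriodicColouring a 4 1 (2 * a) 28 2 7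
colouring[a,4,1] a = tableColouring (blockAbstraction a) (residueAbstraction 4 28) parity (lookup³ table)
  where
  table : Vec (Vec (Vec (Fin 7) 2) 28) 2
  table =
    ((# 0 ∷ # 1 ∷ []) ∷ (# 0 ∷ # 4 ∷ []) ∷ (# 5 ∷ # 4 ∷ []) ∷ (# 5 ∷ # 4 ∷ []) ∷ (# 5 ∷ # 4 ∷ []) ∷ (# 5 ∷ # 0 ∷ []) ∷
     (# 3 ∷ # 0 ∷ []) ∷ (# 3 ∷ # 0 ∷ []) ∷ (# 3 ∷ # 0 ∷ []) ∷ (# 3 ∷ # 5 ∷ []) ∷ (# 6 ∷ # 5 ∷ []) ∷ (# 6 ∷ # 5 ∷ []) ∷
     (# 6 ∷ # 5 ∷ []) ∷ (# 6 ∷ # 3 ∷ []) ∷ (# 2 ∷ # 3 ∷ []) ∷ (# 2 ∷ # 3 ∷ []) ∷ (# 2 ∷ # 3 ∷ []) ∷ (# 2 ∷ # 6 ∷ []) ∷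
     (# 1 ∷ # 6 ∷ []) ∷ (# 1 ∷ # 6 ∷ []) ∷ (# 1 ∷ # 6 ∷ []) ∷ (# 1 ∷ # 2 ∷ []) ∷ (# 4 ∷ # 2 ∷ []) ∷ (# 4 ∷ # 2 ∷ []) ∷
     (# 4 ∷ # 2 ∷ []) ∷ (# 4 ∷ # 1 ∷ []) ∷ (# 0 ∷ # 1 ∷ []) ∷ (# 0 ∷ # 1 ∷ []) ∷ []) ∷
    ((# 2 ∷ # 3 ∷ []) ∷ (# 2 ∷ # 3 ∷ []) ∷ (# 2 ∷ # 3 ∷ []) ∷ (# 2 ∷ # 6 ∷ []) ∷ (# 1 ∷ # 6 ∷ []) ∷ (# 1 ∷ # 6 ∷ []) ∷
     (# 1 ∷ # 6 ∷ []) ∷ (# 1 ∷ # 2 ∷ []) ∷ (# 4 ∷ # 2 ∷ []) ∷ (# 4 ∷ # 2 ∷ []) ∷ (# 4 ∷ # 2 ∷ []) ∷ (# 4 ∷ # 1 ∷ []) ∷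
     (# 0 ∷ # 1 ∷ []) ∷ (# 0 ∷ # 1 ∷ []) ∷ (# 0 ∷ # 1 ∷ []) ∷ (# 0 ∷ # 4 ∷ []) ∷ (# 5 ∷ # 4 ∷ []) ∷ (# 5 ∷ # 4 ∷ []) ∷
     (# 5 ∷ # 4 ∷ []) ∷ (# 5 ∷ # 0 ∷ []) ∷ (# 3 ∷ # 0 ∷ []) ∷ (# 3 ∷ # 0 ∷ []) ∷ (# 3 ∷ # 0 ∷ []) ∷ (# 3 ∷ # 5 ∷ []) ∷
     (# 6 ∷ # 5 ∷ []) ∷ (# 6 ∷ # 5 ∷ []) ∷ (# 6 ∷ # 5 ∷ []) ∷ (# 6 ∷ # 3 ∷ []) ∷ []) ∷
    []

colouring[a,b,c] : ∀ a b c .{{_ : ℕ.NonZero a}} .{{_ : ℕ.NonZero b}} .{{_ : ℕ.NonZero c}} →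
                   PeriodicColouring a b c (2 * a) (2 * b) (2 * c) 8
colouring[a,b,c] a b c =
  tableColouring (blockAbstraction a) (blockAbstraction b) (blockAbstraction c) (lookup³ table)
  where
  table : Vec (Vec (Vec (Fin 8) 2) 2) 2
  table =
    ((# 0 ∷ # 1 ∷ []) ∷ (# 2 ∷ # 3 ∷ []) ∷ []) ∷
    ((# 4 ∷ # 5 ∷ []) ∷ (# 6 ∷ # 7 ∷ []) ∷ []) ∷
    []

-- Lower bounds from contact graphs that cannot be coloured

Graph : ℕ → Set
Graph n = List (Fin n × Fin n)

ProperColouring : ∀ {n k} → (Fin n → Fin k) → Graph n → Set
ProperColouring f = All λ (i , j) → f i ≢ f j

Colourable : ∀ {n} → ℕ → Graph n → Set
Colourable k G = ∃ λ f → ProperColouring {k = k} f G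

-- Colouring vertex 0 turns it into a constant; testing the constraints that have become
-- ground before branching on the next vertex keeps the search small.
module Backtracking (k : ℕ) where

  data Term (n : ℕ) : Set where
    var : Fin n → Term n
    const : Fin k → Term n

  ⟦_⟧ : ∀ {n} → Term n → (Fin n → Fin k) → Fin k
  ⟦ var i ⟧ f = f i
  ⟦ const c ⟧ f = c

  Constraint : ℕ → Set
  Constraint n = Term n × Term n

  Holds : ∀ {n} → (Fin n → Fin k) → Constraint n → Set
  Holds f (t , u) = ⟦ t ⟧ f ≢ ⟦ u ⟧ f

  Satisfiable : ∀ {n} → List (Constraint n) → Set
  Satisfiable E = ∃ λ f → All (Holds f) E

  instantiate : ∀ {n} → Fin k → Term (suc n) → Term n
  instantiate c (var Fin.zero) = const c
  instantiate c (var (Fin.suc i)) = var i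
  instantiate c (const c') = const c'

  ⟦instantiate⟧ : ∀ {n} c (t : Term (suc n)) f → ⟦ instantiate c t ⟧ f ≡ ⟦ t ⟧ (c Vector.∷ f)
  ⟦instantiate⟧ c (var Fin.zero) f = refl
  ⟦instantiate⟧ c (var (Fin.suc i)) f = refl
  ⟦instantiate⟧ c (const c') f = refl

  ⟦instantiate-head⟧ : ∀ {n} (t : Term (suc n)) g → ⟦ instantiate (head g) t ⟧ (tail g) ≡ ⟦ t ⟧ g
  ⟦instantiate-head⟧ (var Fin.zero) g = refl
  ⟦instantiate-head⟧ (var (Fin.suc i)) g = refl
  ⟦instantiate-head⟧ (const c) g = refl

  instantiateAll : ∀ {n} → Fin k → List (Constraint (suc n)) → List (Constraint n)
  instantiateAll c = map λ (t , u) → instantiate c t , instantiate c u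

  All-Holds-instantiateAll⁻ : ∀ {n c f} (E : List (Constraint (suc n))) →
                              All (Holds f) (instantiateAll c E) → All (Holds (c Vector.∷ f)) E
  All-Holds-instantiateAll⁻ {c = c} {f} E holds =
    All.map (λ {(t , u)} → subst₂ _≢_ (⟦instantiate⟧ c t f) (⟦instantiate⟧ c u f)) (Allₚ.map⁻ holds)

  All-Holds-instantiateAll⁺ : ∀ {n g} (E : List (Constraint (suc n))) →
                              All (Holds g) E → All (Holds (tail g)) (instantiateAll (head g) E)
  All-Holds-instantiateAll⁺ {g = g} E holds =
    Allₚ.map⁺ (All.map (λ {(t , u)} →
      subst₂ _≢_ (sym (⟦instantiate-head⟧ t g)) (sym (⟦instantiate-head⟧ u g))) holds)

  GroundConsistent : ∀ {n} → Constraint n → Set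
  GroundConsistent (const c , const c') = c ≢ c'
  GroundConsistent _ = ⊤

  groundConsistent? : ∀ {n} (e : Constraint n) → Dec (GroundConsistent e)
  groundConsistent? (const c , const c') = ¬? (c Finₚ.≟ c')
  groundConsistent? (var _ , _) = yes _
  groundConsistent? (const _ , var _) = yes _

  Holds⇒GroundConsistent : ∀ {n f} (e : Constraint n) → Holds f e → GroundConsistent e
  Holds⇒GroundConsistent (const c , const c') c≢c' = c≢c'
  Holds⇒GroundConsistent (var _ , _) _ = _
  Holds⇒GroundConsistent (const _ , var _) _ = _

  GroundConsistent⇒Holds : ∀ {f} (e : Constraint 0) → GroundConsistent e → Holds f e
  GroundConsistent⇒Holds (const c , const c') c≢c' = c≢c'

  satisfiable? : ∀ {n} (E : List (Constraint n)) → Dec (Satisfiable E)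
  satisfiable? {zero} E = map′
    (λ consistent → (λ ()) , All.map (GroundConsistent⇒Holds _) consistent)
    (λ (_ , holds) → All.map (Holds⇒GroundConsistent _) holds)
    (All.all? groundConsistent? E)
  satisfiable? {suc n} E with All.all? groundConsistent? E
  ... | no inconsistent = no λ (_ , holds) → inconsistent (All.map (Holds⇒GroundConsistent _) holds)
  ... | yes _ = map′
    (λ (c , f , holds) → c Vector.∷ f , All-Holds-instantiateAll⁻ E holds)
    (λ (g , holds) → head g , tail g , All-Holds-instantiateAll⁺ E holds)
    (any? λ c → satisfiable? (instantiateAll c E))

  constraints : ∀ {n} → Graph n → List (Constraint n)
  constraints = map λ (i , j) → var i , var j

colourable? : ∀ {n} k (G : Graph n) → Dec (Colourable k G)
colourable? k G =
  map′ (λ (f , holds) → f , Allₚ.map⁻ holds) (λ (f , proper) → f , Allₚ.map⁺ proper)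
       (satisfiable? (constraints G))
  where open Backtracking k

Realises : ∀ {n} → ℕ → ℕ → ℕ → (Fin n → Root) → Graph n → Set
Realises a b c pos = All λ (i , j) → Touch a b c (pos i) (pos j)

realises? : ∀ {n} a b c (pos : Fin n → Root) (G : Graph n) → Dec (Realises a b c pos G)
realises? a b c pos = All.all? λ (i , j) → touch? a b c (pos i) (pos j)

module _ {a b c X Y Z n : ℕ} {pos : Fin n → Root} {G : Graph n} where

  periodicColouring⇒colourable : ∀ {m} → Realises a b c pos G →
                                 PeriodicColouring a b c X Y Z m → Colourable m G
  periodicColouring⇒colourable touching (κ , _ , proper) = κ ∘ pos , All.map (proper _ _) touching

  colourable-≤ : ∀ {m k} → m ≤ k → Colourable m G → Colourable k G
  colourable-≤ m≤k (f , proper) =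
    (λ i → inject≤ (f i) m≤k) , All.map (λ fi≢fj → fi≢fj ∘ inject≤-injective m≤k m≤k _ _) proper

  noPeriodicColouring : ∀ {k} → Realises a b c pos G → ¬ Colourable k G →
                        ∀ m → m < suc k → ¬ PeriodicColouring a b c X Y Z m
  noPeriodicColouring touching ¬colourable m m<1+k κ =
    ¬colourable (colourable-≤ (ℕ.s≤s⁻¹ m<1+k) (periodicColouring⇒colourable touching κ))

noPeriodicColouring[1,1,1] : ∀ {X Y Z} m → m < 2 → ¬ PeriodicColouring 1 1 1 X Y Z m
noPeriodicColouring[1,1,1] =
  noPeriodicColouring (from-yes (realises? 1 1 1 pos edge)) (from-no (colourable? 1 edge))
  where
  edge : Graph 2
  edge = (# 0 , # 1) ∷ []
  pos : Fin 2 → Root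
  pos = lookup ((+ 0 , + 0 , + 0) ∷ (+ 1 , + 0 , + 0) ∷ [])

noPeriodicColouring[2,1,1] : ∀ {X Y Z} m → m < 3 → ¬ PeriodicColouring 2 1 1 X Y Z m
noPeriodicColouring[2,1,1] =
  noPeriodicColouring (from-yes (realises? 2 1 1 pos triangle)) (from-no (colourable? 2 triangle))
  where
  triangle : Graph 3
  triangle = (# 0 , # 1) ∷ (# 0 , # 2) ∷ (# 1 , # 2) ∷ []
  pos : Fin 3 → Root
  pos = lookup ((+ 0 , + 0 , + 0) ∷ (+ 1 , + 1 , + 0) ∷ (- + 1 , + 1 , + 0) ∷ [])

noPeriodicColouring[2,2,1] : ∀ {X Y Z} m → m < 5 → ¬ PeriodicColouring 2 2 1 X Y Z m
noPeriodicColouring[2,2,1] =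
  noPeriodicColouring (from-yes (realises? 2 2 1 pos graph)) (from-no (colourable? 4 graph))
  where
  graph : Graph 9
  graph = (# 0 , # 2) ∷ (# 0 , # 3) ∷ (# 0 , # 4) ∷ (# 0 , # 6) ∷ (# 0 , # 7) ∷ (# 1 , # 3) ∷
          (# 1 , # 4) ∷ (# 1 , # 5) ∷ (# 1 , # 6) ∷ (# 1 , # 7) ∷ (# 1 , # 8) ∷ (# 2 , # 4) ∷
          (# 2 , # 5) ∷ (# 2 , # 7) ∷ (# 2 , # 8) ∷ (# 3 , # 5) ∷ (# 3 , # 6) ∷ (# 3 , # 7) ∷
          (# 4 , # 6) ∷ (# 4 , # 7) ∷ (# 4 , # 8) ∷ (# 5 , # 7) ∷ (# 5 , # 8) ∷ (# 6 , # 8) ∷ []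
  pos : Fin 9 → Root
  pos = lookup ((+ 0 , + 0 , + 1) ∷ (+ 0 , + 1 , + 1) ∷ (+ 0 , + 2 , + 1) ∷
                (+ 1 , + 0 , + 0) ∷ (+ 1 , + 1 , + 0) ∷ (+ 1 , + 2 , + 0) ∷
                (+ 2 , + 0 , + 1) ∷ (+ 2 , + 1 , + 1) ∷ (+ 2 , + 2 , + 1) ∷ [])

noPeriodicColouring[a,1,1] : ∀ k {X Y Z} m → m < 4 → ¬ PeriodicColouring (3 ℕ.+ k) 1 1 X Y Z m
noPeriodicColouring[a,1,1] k = noPeriodicColouring touching (from-no (colourable? 3 graph))
  where
  a = 3 ℕ.+ k
  x₀ x₁ x₂ x₃ x₄ : ℤ
  x₀ = + 0
  x₁ = + 1
  x₂ = + (2 ℕ.+ k)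
  x₃ = + (3 ℕ.+ k)
  x₄ = + (4 ℕ.+ k)
  pos : Fin 10 → Root
  pos = lookup ((x₀ , + 0 , + 0) ∷ (x₀ , + 0 , + 1) ∷ (x₁ , + 0 , + 0) ∷ (x₁ , + 0 , + 1) ∷
                (x₂ , + 0 , + 0) ∷ (x₂ , + 0 , + 1) ∷ (x₃ , + 0 , + 0) ∷ (x₃ , + 0 , + 1) ∷
                (x₄ , + 0 , + 0) ∷ (x₄ , + 0 , + 1) ∷ [])
  graph : Graph 10
  graph = (# 0 , # 1) ∷ (# 0 , # 3) ∷ (# 0 , # 5) ∷ (# 0 , # 6) ∷ (# 1 , # 2) ∷ (# 1 , # 4) ∷
          (# 1 , # 7) ∷ (# 2 , # 3) ∷ (# 2 , # 5) ∷ (# 2 , # 7) ∷ (# 2 , # 8) ∷ (# 3 , # 4) ∷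
          (# 3 , # 6) ∷ (# 3 , # 9) ∷ (# 4 , # 5) ∷ (# 4 , # 7) ∷ (# 4 , # 9) ∷ (# 5 , # 6) ∷
          (# 5 , # 8) ∷ (# 6 , # 7) ∷ (# 6 , # 9) ∷ (# 7 , # 8) ∷ (# 8 , # 9) ∷ []
  flat : ∀ y → Segment 1 y y
  flat y = Segment-refl {x = y} z<s
  across : ∀ {x x'} z z' → Segment a x x' → Point 1 z z' → Touch a 1 1 (x , + 0 , z) (x' , + 0 , z')
  across _ _ sx pz = inj₂ (inj₂ (Point⇒OpenDisj pz)) , inj₂ (inj₂ (sx , flat (+ 0) , pz))
  stacked : ∀ x → Touch a 1 1 (x , + 0 , + 0) (x , + 0 , + 1)
  stacked x = across (+ 0) (+ 1) (Segment-refl {x = x} z<s) refl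
  up : ∀ x x' {n} → n < a → x' ≡ x + + n → Touch a 1 1 (x , + 0 , + 0) (x' , + 0 , + 1)
  up x x' n<a x'≡x+n = across (+ 0) (+ 1) (offset⇒Segment {x = x} n<a x'≡x+n) refl
  down : ∀ x x' {n} → n < a → x' ≡ x + + n → Touch a 1 1 (x , + 0 , + 1) (x' , + 0 , + 0)
  down x x' n<a x'≡x+n = across (+ 1) (+ 0) (offset⇒Segment {x = x} n<a x'≡x+n) refl
  along : ∀ x x' z → x' ≡ x + + a → Touch a 1 1 (x , + 0 , z) (x' , + 0 , z)
  along x _ z x'≡x+a = inj₁ (Point⇒OpenDisj px) , inj₁ (px , flat (+ 0) , flat z)
    where px = offset⇒Point {x = x} x'≡x+a
  1<a : 1 < a
  1<a = s≤s (s≤s z≤n)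
  2<a : 2 < a
  2<a = s≤s (s≤s (s≤s z≤n))
  1+k<a : 1 ℕ.+ k < a
  1+k<a = s≤s (s≤s (ℕₚ.n≤1+n k))
  2+k<a : 2 ℕ.+ k < a
  2+k<a = ℕₚ.n<1+n (2 ℕ.+ k)
  touching : Realises a 1 1 pos graph
  -- For the columns depending on k, + n + x computes to the next column, x + + n does not.
  touching =
    stacked x₀ ∷
    up x₀ x₁ 1<a refl ∷
    up x₀ x₂ 2+k<a refl ∷
    along x₀ x₃ (+ 0) refl ∷
    down x₀ x₁ 1<a refl ∷
    down x₀ x₂ 2+k<a refl ∷
    along x₀ x₃ (+ 1) refl ∷
    stacked x₁ ∷
    up x₁ x₂ 1+k<a refl ∷
    up x₁ x₃ 2+k<a refl ∷
    along x₁ x₄ (+ 0) refl ∷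
    down x₁ x₂ 1+k<a refl ∷
    down x₁ x₃ 2+k<a refl ∷
    along x₁ x₄ (+ 1) refl ∷
    stacked x₂ ∷
    up x₂ x₃ 1<a (ℤₚ.+-comm (+ 1) x₂) ∷
    up x₂ x₄ 2<a (ℤₚ.+-comm (+ 2) x₂) ∷
    down x₂ x₃ 1<a (ℤₚ.+-comm (+ 1) x₂) ∷
    down x₂ x₄ 2<a (ℤₚ.+-comm (+ 2) x₂) ∷
    stacked x₃ ∷
    up x₃ x₄ 1<a (ℤₚ.+-comm (+ 1) x₃) ∷
    down x₃ x₄ 1<a (ℤₚ.+-comm (+ 1) x₃) ∷
    stacked x₄ ∷ []

χ₁≤P₁ : ∀ {a b c X Y Z} → Chi≤P₁ a b c X Y Z
χ₁≤P₁ _ (κ , _ , proper) _ _ = κ , λ _ _ → proper _ _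

theorem3p3 :
    (Chi≤P₁ 1 1 1 2 2 2 × P₁≡ 1 1 1 2 2 2 2)
    × (Chi≤P₁ 2 1 1 6 2 2 × P₁≡ 2 1 1 6 2 2 3)
    × (∀ (a : ℕ) → 3 ≤ a → Chi≤P₁ a 1 1 (2 * a) 2 2 × P₁≡ a 1 1 (2 * a) 2 2 4)
    × (Chi≤P₁ 2 2 1 10 10 2 × P₁≡ 2 2 1 10 10 2 5)
    × (∀ (a : ℕ) → 3 ≤ a → Chi≤P₁ a 2 1 (2 * a) 12 2 × P₁≤ a 2 1 (2 * a) 12 2 6)
    × (∀ (a : ℕ) → 3 ≤ a → Chi≤P₁ a 3 1 (2 * a) 21 2 × P₁≤ a 3 1 (2 * a) 21 2 7)
    × (∀ (a : ℕ) → 4 ≤ a → Chi≤P₁ a 4 1 (2 * a) 28 2 × P₁≤ a 4 1 (2 * a) 28 2 7)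
    × (∀ (a b c : ℕ) → 1 ≤ c → c ≤ b → b ≤ a →
         Chi≤P₁ a b c (2 * a) (2 * b) (2 * c) × P₁≤ a b c (2 * a) (2 * b) (2 * c) 8)
theorem3p3 =
    (χ₁≤P₁ , colouring[1,1,1] , noPeriodicColouring[1,1,1])
  , (χ₁≤P₁ , colouring[2,1,1] , noPeriodicColouring[2,1,1])
  , (λ { a@(suc (suc (suc k))) (s≤s (s≤s (s≤s _))) →
           χ₁≤P₁ , colouring[a,1,1] a , noPeriodicColouring[a,1,1] k })
  , (χ₁≤P₁ , colouring[2,2,1] , noPeriodicColouring[2,2,1])
  , (λ { a@(suc _) (s≤s _) → χ₁≤P₁ , (6 , ℕₚ.≤-refl , colouring[a,2,1] a) })
  , (λ { a@(suc _) (s≤s _) → χ₁≤P₁ , (7 , ℕₚ.≤-refl , colouring[a,3,1] a) })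
  , (λ { a@(suc _) (s≤s _) → χ₁≤P₁ , (7 , ℕₚ.≤-refl , colouring[a,4,1] a) })
  , (λ { a@(suc _) b@(suc _) c@(suc _) (s≤s _) (s≤s _) (s≤s _) →
           χ₁≤P₁ , (8 , ℕₚ.≤-refl , colouring[a,b,c] a b c) })
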